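{- Let $x=\sum_{i=0}^\infty2^{e_i}\in\mathbb{Z}_2$ with integers $0\le e_0<e_1<\cdots$, and suppose there is a positive integer $N$ such that $e_k>k+\sum_{i=0}^{k-1}2^{e_i}$ for all $k\ge N$. Then $\bar f(x)$ is $2$-definable, where $f(n)=\sum_{j=0}^n\binom nj^{ -1}$.
   Context: For $x=\sum_{i\ge0}\varepsilon_i2^i\in\mathbb{Z}_2$ with $\varepsilon_i\in\{0,1\}$, let $x_n=\sum_{i=0}^n\varepsilon_i2^i$. One says $\bar f(x)$ is $2$-definable if $\lim_{n\to\infty}f(x_n)$ exists in $\mathbb{Q}_2$ (2-adic topology), and then $\bar f(x)$ is this limit. -}

module Defs where

open import Data.Nat as ℕ using (ℕ; zero; suc; _≤_; _<_; _^_)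
open import Data.Nat.Divisibility using (_∣_)
open import Data.Nat.Combinatorics using (_C_)
open import Data.Integer as ℤ using (ℤ; ∣_∣)
open import Data.Rational as ℚ using (ℚ; ↥_; ↧ₙ_)
open import Data.Bool using (Bool; true; false; if_then_else_; _∨_)
open import Relation.Nullary using (¬_)
open import Relation.Nullary.Decidable using (⌊_⌋)
open import Data.Product using (Σ; _×_)

sumℕ≤ : ℕ → (ℕ → ℕ) → ℕ
sumℕ≤ zero    g = g 0
sumℕ≤ (suc n) g = sumℕ≤ n g ℕ.+ g (suc n)

sumℕ< : ℕ → (ℕ → ℕ) → ℕ
sumℕ< zero    g = 0
sumℕ< (suc k) g = sumℕ< k g ℕ.+ g k

sumℚ≤ : ℕ → (ℕ → ℚ) → ℚ
sumℚ≤ zero    g = g 0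
sumℚ≤ (suc n) g = sumℚ≤ n g ℚ.+ g (suc n)

-- 1/m as a rational (m ≠ 0 in all uses; 1/0 := 0 is a junk value)
invℕ : ℕ → ℚ
invℕ zero    = ℚ.0ℚ
invℕ (suc m) = ℤ.+ 1 ℚ./ suc m

f : ℕ → ℚ
f n = sumℚ≤ n (λ j → invℕ (n C j))

-- does some k ≤ i satisfy e k = i ?  (for strictly increasing e, e k = i forces k ≤ i)
hitsUpTo : (ℕ → ℕ) → ℕ → ℕ → Bool
hitsUpTo e i zero    = ⌊ e 0 ℕ.≟ i ⌋
hitsUpTo e i (suc k) = hitsUpTo e i k ∨ ⌊ e (suc k) ℕ.≟ i ⌋

-- binary digit ε_i of x = Σ_k 2^{e_k}
digit : (ℕ → ℕ) → ℕ → ℕ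
digit e i = if hitsUpTo e i i then 1 else 0

partial : (ℕ → ℕ) → ℕ → ℕ
partial e n = sumℕ≤ n (λ i → digit e i ℕ.* 2 ^ i)

StrictlyIncreasing : (ℕ → ℕ) → Set
StrictlyIncreasing e = ∀ k → e k < e (suc k)

-- q ∈ 2^M ℤ_(2)  (q written in lowest terms: 2^M divides the numerator, the denominator is odd)
TwoAdicSmall : ℕ → ℚ → Set
TwoAdicSmall M q = (2 ^ M ∣ ∣ ↥ q ∣) × ¬ (2 ∣ ↧ₙ q)

-- a sequence of rationals is Cauchy for the 2-adic absolute value
-- (equivalently, it converges in ℚ₂, the completion of ℚ)
TwoAdicCauchy : (ℕ → ℚ) → Set
TwoAdicCauchy a = ∀ (M : ℕ) → Σ ℕ λ K → ∀ m n → K ≤ m → K ≤ n → TwoAdicSmall M (a m ℚ.- a n)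

TwoDefinable : (ℕ → ℚ) → (ℕ → ℕ) → Set
TwoDefinable g e = TwoAdicCauchy (λ n → g (partial e n))

{-# OPTIONS --safe #-}
-- The sum f(n) = Σⱼ 1/C(n,j) satisfies 2n f(n) = (n+1) f(n−1) + 2n, so that g(n) = 2ⁿ f(n)/(n+1)
-- has increments 2ⁿ/(n+1). All binomial coefficients of q = 2^(E+1) − 1 are odd, so f(q) is a
-- 2-adic integer; writing both f(s) and f(s + 2^E) through f(q) and these increments shows that
-- f(s + 2^E) − f(s) has 2-adic valuation at least E − s − 3. The partial sums x_n of x run through
-- the prefixes Σ_{i<k} 2^(e_i), consecutive prefixes s and s + 2^(e_k) satisfy e_k > k + s by the
-- growth condition, and so f(x_n) is 2-adically Cauchy.
module Submission where

open import Defs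
open import Data.Nat using (ℕ; _≤_; _<_; _+_; _^_; NonZero)
open import Data.Product using (Σ)

open import Data.Bool using (true; false; _∨_)
open import Data.Bool.Properties using (∨-zeroʳ)
open import Data.Empty using (⊥-elim)
open import Data.Integer as ℤ using (ℤ; ∣_∣)
import Data.Integer.Properties as ℤₚ
import Data.Integer.Tactic.RingSolver as ℤ-Solver
open import Data.Nat using (zero; suc; _*_; _∸_; _≟_; z≤n; s≤s; z<s; _≤?_; _<?_; >-nonZero)
open import Data.Nat.Combinatorics using (_C_; nC1≡n; nCn≡1; nCk+nC[k+1]≡[n+1]C[k+1])
import Data.Nat.Coprimality as Coprimality
open import Data.Nat.Divisibility
open import Data.Nat.Induction using (<-rec)
open import Data.Nat.Properties
import Data.Nat.Tactic.RingSolver as ℕ-Solver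
open import Data.Product using (_,_; _×_; proj₂)
open import Data.Rational as ℚ using (ℚ; mkℚ; 0ℚ; 1ℚ; toℚᵘ; ↥_; ↧_; ↧ₙ_)
import Data.Rational.Properties as ℚₚ
import Data.Rational.Unnormalised as ℚᵘ
import Data.Rational.Unnormalised.Properties as ℚᵘₚ
open import Data.Sum using (_⊎_; inj₁; inj₂)
open import Level using (0ℓ)
open import Relation.Binary.Definitions using (tri<; tri≈; tri>)
open import Relation.Binary.PropositionalEquality
open import Relation.Nullary using (¬_; yes; no)
open import Relation.Nullary.Decidable using (dec⇒maybe; isYes≗does; dec-true; dec-false)
open import Tactic.RingSolver using (solve-∀)
open import Tactic.RingSolver.Core.AlmostCommutativeRing using (AlmostCommutativeRing; fromCommutativeRing)

-- Parity and powers of two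

Odd : ℕ → Set
Odd n = Σ ℕ λ t → n ≡ suc (2 * t)

even⊎odd : ∀ n → Σ ℕ λ t → (n ≡ 2 * t) ⊎ (n ≡ suc (2 * t))
even⊎odd zero = 0 , inj₁ refl
even⊎odd (suc n) with even⊎odd n
... | t , inj₁ n≡2t   = t , inj₂ (cong suc n≡2t)
... | t , inj₂ n≡1+2t = suc t , inj₁ (trans (cong suc n≡1+2t) (sym (+-suc (suc t) (t + 0))))

odd-* : ∀ {m n} → Odd m → Odd n → Odd (m * n)
odd-* (s , refl) (t , refl) = 2 * s * t + s + t , expand s t
  where
  expand : ∀ s t → suc (2 * s) * suc (2 * t) ≡ suc (2 * (2 * s * t + s + t))
  expand = ℕ-Solver.solve-∀

odd-*-cancelʳ : ∀ {m n} → Odd (m * n) → Odd n → Odd m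
odd-*-cancelʳ {m} (q , mn≡1+2q) (t , refl) with even⊎odd m
... | s , inj₂ m≡1+2s = s , m≡1+2s
... | s , inj₁ refl   = ⊥-elim (even≢odd (s * suc (2 * t)) q (trans (sym (*-assoc 2 s (suc (2 * t)))) mn≡1+2q))

2∤odd : ∀ t → ¬ 2 ∣ suc (2 * t)
2∤odd t (divides q eq) = even≢odd q t (trans (*-comm 2 q) (sym eq))

2∣*odd⇒2∣ : ∀ x t → 2 ∣ x * suc (2 * t) → 2 ∣ x
2∣*odd⇒2∣ x t 2∣x*o = ∣m+n∣m⇒∣n (subst (2 ∣_) (expand x t) 2∣x*o) (m∣m*n (x * t))
  where
  expand : ∀ x t → x * suc (2 * t) ≡ 2 * (x * t) + x
  expand = ℕ-Solver.solve-∀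

2^∣*odd⇒2^∣ : ∀ M x t → 2 ^ M ∣ x * suc (2 * t) → 2 ^ M ∣ x
2^∣*odd⇒2^∣ zero    x t _ = 1∣ x
2^∣*odd⇒2^∣ (suc M) x t 2^[1+M]∣x*o with 2∣*odd⇒2∣ x t (∣-trans (m∣m*n (2 ^ M)) 2^[1+M]∣x*o)
... | divides y refl = subst (2 ^ suc M ∣_) (*-comm 2 y) (*-monoʳ-∣ 2 (2^∣*odd⇒2^∣ M y t 2^M∣y*o))
  where
  2^M∣y*o : 2 ^ M ∣ y * suc (2 * t)
  2^M∣y*o = *-cancelˡ-∣ 2 (subst (2 * 2 ^ M ∣_) (*-assoc-swap y (suc (2 * t))) 2^[1+M]∣x*o)
    where
    *-assoc-swap : ∀ y o → y * 2 * o ≡ 2 * (y * o)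
    *-assoc-swap = ℕ-Solver.solve-∀

pow₂*odd-decomposition : ∀ m → Σ ℕ λ v → Σ ℕ λ t → 2 ^ v * suc (2 * t) ≡ suc m
pow₂*odd-decomposition = <-rec _ decompose
  where
  Decomposition : ℕ → Set
  Decomposition m = Σ ℕ λ v → Σ ℕ λ t → 2 ^ v * suc (2 * t) ≡ suc m
  halve : ∀ {m h} → suc m ≡ 2 * suc h → Decomposition h → Decomposition m
  halve 1+m≡2[1+h] (v , t , eq) = suc v , t , trans (*-assoc 2 (2 ^ v) _) (trans (cong (2 *_) eq) (sym 1+m≡2[1+h]))
  decompose : ∀ m → (∀ {k} → k < m → Decomposition k) → Decomposition m
  decompose m rec with even⊎odd (suc m)
  ... | t     , inj₂ 1+m≡1+2t   = 0 , t , trans (+-identityʳ _) (sym 1+m≡1+2t)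
  ... | suc h , inj₁ 1+m≡2[1+h] =
    halve 1+m≡2[1+h] (rec (subst (h <_) (sym (suc-injective 1+m≡2[1+h])) (m<m+n h z<s)))

^-cancelʳ-≤ : ∀ b → 1 < b → ∀ {m n} → b ^ m ≤ b ^ n → m ≤ n
^-cancelʳ-≤ b 1<b {m} {n} b^m≤b^n with n <? m
... | yes n<m = ⊥-elim (<⇒≱ (^-monoʳ-< b 1<b n<m) b^m≤b^n)
... | no  n≮m = ≮⇒≥ n≮m

^-cancelʳ-< : ∀ b → 1 < b → ∀ {m n} → b ^ m < b ^ n → m < n
^-cancelʳ-< b 1<b {m} {n} b^m<b^n with n ≤? m
... | yes n≤m = ⊥-elim (<⇒≱ b^m<b^n (^-monoʳ-≤ b {{>-nonZero (<-trans z<s 1<b)}} n≤m))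
... | no  n≰m = ≰⇒> n≰m

m^i∣m^j : ∀ m {i j} → i ≤ j → m ^ i ∣ m ^ j
m^i∣m^j m {i} i≤j with m≤n⇒∃[o]m+o≡n i≤j
... | d , refl = divides (m ^ d) (trans (^-distribˡ-+-* m i d) (*-comm (m ^ i) (m ^ d)))

2*n≤2^n : ∀ n → 2 * n ≤ 2 ^ n
2*n≤2^n zero          = z≤n
2*n≤2^n (suc zero)    = ≤-refl
2*n≤2^n (suc (suc n)) = begin
  2 * suc (suc n)              ≡⟨ expand n ⟩
  2 * suc n + 2                ≤⟨ +-mono-≤ (2*n≤2^n (suc n)) (*-monoʳ-≤ 2 (m^n>0 2 n)) ⟩
  2 ^ suc n + 2 ^ suc n        ≡⟨ cong (2 ^ suc n +_) (+-identityʳ (2 ^ suc n)) ⟨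
  2 ^ suc (suc n)              ∎
  where
  open ≤-Reasoning
  expand : ∀ n → 2 * suc (suc n) ≡ 2 * suc n + 2
  expand = ℕ-Solver.solve-∀

2^v*odd+k≡2^r⇒k≡2^v*odd : ∀ v {u k} r → 2 ^ v * suc (2 * u) + k ≡ 2 ^ r → 0 < k →
                          Σ ℕ λ w → k ≡ 2 ^ v * suc (2 * w)
2^v*odd+k≡2^r⇒k≡2^v*odd v {u} {k} r total 0<k =
  odd-quotient (∣m+n∣m⇒∣n (subst (2 ^ v ∣_) (sym total′) (m∣m*n (2 * 2 ^ o))) (m∣m*n (suc (2 * u))))
  where
  v<r : v < r
  v<r = ^-cancelʳ-< 2 (s≤s (s≤s z≤n)) (≤-<-trans (m≤m*n (2 ^ v) (suc (2 * u))) (subst (2 ^ v * suc (2 * u) <_) total (m<m+n _ 0<k)))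
  o = r ∸ suc v
  total′ : 2 ^ v * suc (2 * u) + k ≡ 2 ^ v * (2 * 2 ^ o)
  total′ = trans total (trans (cong (2 ^_) (trans (sym (m+[n∸m]≡n v<r)) (sym (+-suc v o)))) (^-distribˡ-+-* 2 v (suc o)))
  odd-quotient : 2 ^ v ∣ k → Σ ℕ λ w → k ≡ 2 ^ v * suc (2 * w)
  odd-quotient (divides w′ refl) with even⊎odd w′
  ... | w , inj₂ w′≡1+2w = w , trans (*-comm w′ (2 ^ v)) (cong (2 ^ v *_) w′≡1+2w)
  ... | c , inj₁ refl    = ⊥-elim (even≢odd (2 ^ o) (u + c) (trans (sym cancelled) (odd+even u c)))
    where
    cancelled : suc (2 * u) + 2 * c ≡ 2 * 2 ^ o
    cancelled = *-cancelˡ-≡ _ _ (2 ^ v) {{m^n≢0 2 v}}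
      (trans (*-distribˡ-+ (2 ^ v) (suc (2 * u)) (2 * c)) (trans (cong (2 ^ v * suc (2 * u) +_) (*-comm (2 ^ v) (2 * c))) total′))
    odd+even : ∀ u c → suc (2 * u) + 2 * c ≡ suc (2 * (u + c))
    odd+even = ℕ-Solver.solve-∀

2^e∣2^E+y⇒2^e≤2*y : ∀ e E {x y} → 0 < y → y ≤ 2 ^ E → 2 ^ e * suc x ≡ 2 ^ E + y → 2 ^ e ≤ 2 * y
2^e∣2^E+y⇒2^e≤2*y e E {x} {y} 0<y y≤2^E eq with e ≤? E
... | yes e≤E = ≤-trans (∣⇒≤ {{>-nonZero 0<y}} 2^e∣y) (m≤m+n y (y + 0))
  where
  2^e∣y : 2 ^ e ∣ y
  2^e∣y = ∣m+n∣m⇒∣n (subst (2 ^ e ∣_) eq (m∣m*n (suc x))) (m^i∣m^j 2 e≤E)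
... | no  e≰E = begin
  2 ^ e        ≤⟨ 2^e≤2^E+y ⟩
  2 ^ E + y    ≤⟨ +-monoˡ-≤ y 2^E≤y ⟩
  y + y        ≡⟨ cong (y +_) (+-identityʳ y) ⟨
  2 * y        ∎
  where
  open ≤-Reasoning
  2^e≤2^E+y : 2 ^ e ≤ 2 ^ E + y
  2^e≤2^E+y = subst (2 ^ e ≤_) eq (m≤m*n (2 ^ e) (suc x))
  2^E≤y : 2 ^ E ≤ y
  2^E≤y = +-cancelˡ-≤ (2 ^ E) (2 ^ E) y (begin
    2 ^ E + 2 ^ E   ≡⟨ cong (2 ^ E +_) (+-identityʳ (2 ^ E)) ⟨
    2 ^ suc E       ≤⟨ ^-monoʳ-≤ 2 (≰⇒> e≰E) ⟩
    2 ^ e           ≤⟨ 2^e≤2^E+y ⟩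
    2 ^ E + y       ∎)

exponent-sum-bound : ∀ e₁ e₂ {y} → 2 ^ e₁ ≤ y → 2 ^ e₂ ≤ 2 * y → e₁ + e₂ ≤ suc y
exponent-sum-bound e₁ e₂ {y} 2^e₁≤y 2^e₂≤2y = *-cancelˡ-≤ 2 (begin
  2 * (e₁ + e₂)          ≡⟨ *-distribˡ-+ 2 e₁ e₂ ⟩
  2 * e₁ + 2 * e₂        ≤⟨ +-mono-≤ (≤-trans (2*n≤2^n e₁) 2^e₁≤y) (2*e₂≤y+2 e₂ 2^e₂≤2y) ⟩
  y + (y + 2)            ≡⟨ rearrange y ⟩
  2 * suc y              ∎)
  where
  open ≤-Reasoning
  rearrange : ∀ y → y + (y + 2) ≡ 2 * suc y
  rearrange = ℕ-Solver.solve-∀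
  2*e₂≤y+2 : ∀ e → 2 ^ e ≤ 2 * y → 2 * e ≤ y + 2
  2*e₂≤y+2 zero    _      = z≤n
  2*e₂≤y+2 (suc e) 2^e≤2y = subst (_≤ y + 2) (expand e) (+-monoˡ-≤ 2 (≤-trans (2*n≤2^n e) (*-cancelˡ-≤ 2 2^e≤2y)))
    where
    expand : ∀ e → 2 * e + 2 ≡ 2 * suc e
    expand = ℕ-Solver.solve-∀

-- Binomial coefficients

nCk>0 : ∀ {n k} → k ≤ n → 0 < (n C k)
nCk>0 {n}     {zero}  _         = z<s
nCk>0 {suc n} {suc k} (s≤s k≤n) =
  subst (0 <_) (nCk+nC[k+1]≡[n+1]C[k+1] n k) (<-≤-trans (nCk>0 k≤n) (m≤m+n (n C k) (n C suc k)))

[n+1]C[k+1]*[k+1]≡[n+1]*nCk : ∀ n k → (suc n C suc k) * suc k ≡ suc n * (n C k)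
[n+1]C[k+1]*[k+1]≡[n+1]*nCk zero    zero    = refl
[n+1]C[k+1]*[k+1]≡[n+1]*nCk zero    (suc k) = refl
[n+1]C[k+1]*[k+1]≡[n+1]*nCk (suc n) zero    =
  trans (*-identityʳ (suc (suc n) C 1)) (trans (nC1≡n (suc (suc n))) (sym (*-identityʳ (suc (suc n)))))
[n+1]C[k+1]*[k+1]≡[n+1]*nCk (suc n) (suc k) = begin
  (suc (suc n) C suc (suc k)) * suc (suc k)   ≡⟨ cong (_* suc (suc k)) (pascal (suc n) (suc k)) ⟨
  (a + b) * suc (suc k)                     ≡⟨ expand a b k ⟩
  a * suc k + a + b * suc (suc k)           ≡⟨ cong₂ (λ x y → x + a + y) (absorption n k) (absorption n (suc k)) ⟩
  suc n * c + a + suc n * d                 ≡⟨ cong (λ x → suc n * c + x + suc n * d) (pascal n k) ⟨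
  suc n * c + (c + d) + suc n * d           ≡⟨ collect n c d ⟩
  suc (suc n) * (c + d)                     ≡⟨ cong (suc (suc n) *_) (pascal n k) ⟩
  suc (suc n) * a                           ∎
  where
  open ≡-Reasoning
  pascal = nCk+nC[k+1]≡[n+1]C[k+1]
  absorption = [n+1]C[k+1]*[k+1]≡[n+1]*nCk
  a = (suc n C suc k)
  b = (suc n C suc (suc k))
  c = (n C k)
  d = (n C suc k)
  expand : ∀ a b k → (a + b) * suc (suc k) ≡ a * suc k + a + b * suc (suc k)
  expand = ℕ-Solver.solve-∀
  collect : ∀ n c d → suc n * c + (c + d) + suc n * d ≡ suc (suc n) * (c + d)
  collect = ℕ-Solver.solve-∀

k*nCk+[k+1]*nC[k+1]≡n*nCk : ∀ n k → k * (n C k) + suc k * (n C suc k) ≡ n * (n C k)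
k*nCk+[k+1]*nC[k+1]≡n*nCk zero    zero    = refl
k*nCk+[k+1]*nC[k+1]≡n*nCk zero    (suc k) = cong₂ _+_ (*-zeroʳ (suc k)) (*-zeroʳ (suc (suc k)))
k*nCk+[k+1]*nC[k+1]≡n*nCk (suc n) zero    = trans (*-identityˡ (suc n C 1)) (trans (nC1≡n (suc n)) (sym (*-identityʳ (suc n))))
k*nCk+[k+1]*nC[k+1]≡n*nCk (suc n) (suc k) = begin
  suc k * (suc n C suc k) + suc (suc k) * (suc n C suc (suc k))
    ≡⟨ cong₂ _+_ (*-comm (suc k) (suc n C suc k)) (*-comm (suc (suc k)) (suc n C suc (suc k))) ⟩
  (suc n C suc k) * suc k + (suc n C suc (suc k)) * suc (suc k)
    ≡⟨ cong₂ _+_ ([n+1]C[k+1]*[k+1]≡[n+1]*nCk n k) ([n+1]C[k+1]*[k+1]≡[n+1]*nCk n (suc k)) ⟩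
  suc n * (n C k) + suc n * (n C suc k)  ≡⟨ *-distribˡ-+ (suc n) (n C k) (n C suc k) ⟨
  suc n * (n C k + (n C suc k))        ≡⟨ cong (suc n *_) (nCk+nC[k+1]≡[n+1]C[k+1] n k) ⟩
  suc n * (suc n C suc k)              ∎
  where open ≡-Reasoning

nC[k+1]*[k+1]≡nCk*[n∸k] : ∀ n k → (n C suc k) * suc k ≡ (n C k) * (n ∸ k)
nC[k+1]*[k+1]≡nCk*[n∸k] n k = begin
  (n C suc k) * suc k                                   ≡⟨ *-comm (n C suc k) (suc k) ⟩
  suc k * (n C suc k)                                   ≡⟨ m+n∸m≡n (k * (n C k)) _ ⟨
  k * (n C k) + suc k * (n C suc k) ∸ k * (n C k)           ≡⟨ cong (_∸ k * (n C k)) (k*nCk+[k+1]*nC[k+1]≡n*nCk n k) ⟩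
  n * (n C k) ∸ k * (n C k)                               ≡⟨ *-distribʳ-∸ (n C k) n k ⟨
  (n ∸ k) * (n C k)                                     ≡⟨ *-comm (n ∸ k) (n C k) ⟩
  (n C k) * (n ∸ k)                                     ∎
  where open ≡-Reasoning

-- (k+1)·C(n,k+1) = (n−k)·C(n,k), and since (k+1) + (n−k) = 2^r, the factors k+1 and n−k
-- have the same 2-adic valuation.
[2^r∸1]Ck-odd : ∀ r {n} → suc n ≡ 2 ^ r → ∀ k → k ≤ n → Odd (n C k)
[2^r∸1]Ck-odd _ _ zero _ = 0 , refl
[2^r∸1]Ck-odd r {n} 1+n≡2^r (suc k) k<n with pow₂*odd-decomposition k
... | v , u , 2^v*o≡1+k
  with 2^v*odd+k≡2^r⇒k≡2^v*odd v {u} r (trans (cong (_+ (n ∸ k)) 2^v*o≡1+k) (trans (cong suc (m+[n∸m]≡n (<⇒≤ k<n))) 1+n≡2^r))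
                                       (m<n⇒0<n∸m k<n)
...   | w , n∸k≡2^v*o′ = odd-*-cancelʳ (subst Odd (sym ratio) (odd-* ([2^r∸1]Ck-odd r 1+n≡2^r k (<⇒≤ k<n)) (w , refl))) (u , refl)
  where
  ratio : (n C suc k) * suc (2 * u) ≡ (n C k) * suc (2 * w)
  ratio = *-cancelˡ-≡ _ _ (2 ^ v) {{m^n≢0 2 v}} (begin
    2 ^ v * ((n C suc k) * suc (2 * u))   ≡⟨ x*[y*z]≡y*[x*z] (2 ^ v) (n C suc k) (suc (2 * u)) ⟩
    (n C suc k) * (2 ^ v * suc (2 * u))   ≡⟨ cong ((n C suc k) *_) 2^v*o≡1+k ⟩
    (n C suc k) * suc k                   ≡⟨ nC[k+1]*[k+1]≡nCk*[n∸k] n k ⟩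
    (n C k) * (n ∸ k)                     ≡⟨ cong ((n C k) *_) n∸k≡2^v*o′ ⟩
    (n C k) * (2 ^ v * suc (2 * w))       ≡⟨ x*[y*z]≡y*[x*z] (n C k) (2 ^ v) (suc (2 * w)) ⟩
    2 ^ v * ((n C k) * suc (2 * w))       ∎)
    where
    open ≡-Reasoning
    x*[y*z]≡y*[x*z] : ∀ x y z → x * (y * z) ≡ y * (x * z)
    x*[y*z]≡y*[x*z] = ℕ-Solver.solve-∀

ℚ-ring : AlmostCommutativeRing 0ℓ 0ℓ
ℚ-ring = fromCommutativeRing ℚₚ.+-*-commutativeRing (λ x → dec⇒maybe (0ℚ ℚₚ.≟ x))

fromℤ : ℤ → ℚ
fromℤ a = a ℚ./ 1

fromℕ : ℕ → ℚ
fromℕ n = fromℤ (ℤ.+ n)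

module _ where
  open ℚᵘₚ.≃-Reasoning

  toℚᵘ-fromℤ : ∀ a → toℚᵘ (fromℤ a) ℚᵘ.≃ ℚᵘ.mkℚᵘ a 0
  toℚᵘ-fromℤ a = ℚₚ.toℚᵘ-fromℚᵘ (ℚᵘ.mkℚᵘ a 0)

  fromℤ-homo-+ : ∀ a b → fromℤ (a ℤ.+ b) ≡ fromℤ a ℚ.+ fromℤ b
  fromℤ-homo-+ a b = ℚₚ.toℚᵘ-injective (begin
    toℚᵘ (fromℤ (a ℤ.+ b))                ≈⟨ toℚᵘ-fromℤ (a ℤ.+ b) ⟩
    ℚᵘ.mkℚᵘ (a ℤ.+ b) 0                   ≈⟨ ℚᵘ.*≡* (ring a b) ⟩
    ℚᵘ.mkℚᵘ a 0 ℚᵘ.+ ℚᵘ.mkℚᵘ b 0          ≈⟨ ℚᵘₚ.+-cong (toℚᵘ-fromℤ a) (toℚᵘ-fromℤ b) ⟨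
    toℚᵘ (fromℤ a) ℚᵘ.+ toℚᵘ (fromℤ b)    ≈⟨ ℚₚ.toℚᵘ-homo-+ (fromℤ a) (fromℤ b) ⟨
    toℚᵘ (fromℤ a ℚ.+ fromℤ b)            ∎)
    where
    ring : ∀ a b → (a ℤ.+ b) ℤ.* (ℤ.+ 1 ℤ.* ℤ.+ 1) ≡ (a ℤ.* ℤ.+ 1 ℤ.+ b ℤ.* ℤ.+ 1) ℤ.* ℤ.+ 1
    ring = ℤ-Solver.solve-∀

  fromℤ-homo-* : ∀ a b → fromℤ (a ℤ.* b) ≡ fromℤ a ℚ.* fromℤ b
  fromℤ-homo-* a b = ℚₚ.toℚᵘ-injective (begin
    toℚᵘ (fromℤ (a ℤ.* b))                ≈⟨ toℚᵘ-fromℤ (a ℤ.* b) ⟩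
    ℚᵘ.mkℚᵘ (a ℤ.* b) 0                   ≈⟨ ℚᵘ.*≡* (ring a b) ⟩
    ℚᵘ.mkℚᵘ a 0 ℚᵘ.* ℚᵘ.mkℚᵘ b 0          ≈⟨ ℚᵘₚ.*-cong (toℚᵘ-fromℤ a) (toℚᵘ-fromℤ b) ⟨
    toℚᵘ (fromℤ a) ℚᵘ.* toℚᵘ (fromℤ b)    ≈⟨ ℚₚ.toℚᵘ-homo-* (fromℤ a) (fromℤ b) ⟨
    toℚᵘ (fromℤ a ℚ.* fromℤ b)            ∎)
    where
    ring : ∀ a b → (a ℤ.* b) ℤ.* (ℤ.+ 1 ℤ.* ℤ.+ 1) ≡ (a ℤ.* b) ℤ.* ℤ.+ 1
    ring = ℤ-Solver.solve-∀

  fromℤ-homo-‿ : ∀ a → fromℤ (ℤ.- a) ≡ ℚ.- fromℤ a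
  fromℤ-homo-‿ a = ℚₚ.toℚᵘ-injective (begin
    toℚᵘ (fromℤ (ℤ.- a))      ≈⟨ toℚᵘ-fromℤ (ℤ.- a) ⟩
    ℚᵘ.- ℚᵘ.mkℚᵘ a 0          ≈⟨ ℚᵘₚ.-‿cong (toℚᵘ-fromℤ a) ⟨
    ℚᵘ.- toℚᵘ (fromℤ a)       ≈⟨ ℚₚ.toℚᵘ-homo‿- (fromℤ a) ⟨
    toℚᵘ (ℚ.- fromℤ a)        ∎)

  fromℕ-*-invℕ : ∀ n → .{{NonZero n}} → fromℕ n ℚ.* invℕ n ≡ 1ℚ
  fromℕ-*-invℕ (suc m) = ℚₚ.toℚᵘ-injective (begin
    toℚᵘ (fromℕ (suc m) ℚ.* invℕ (suc m))
      ≈⟨ ℚₚ.toℚᵘ-homo-* (fromℕ (suc m)) (invℕ (suc m)) ⟩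
    toℚᵘ (fromℕ (suc m)) ℚᵘ.* toℚᵘ (invℕ (suc m))
      ≈⟨ ℚᵘₚ.*-cong (toℚᵘ-fromℤ (ℤ.+ suc m)) (ℚₚ.toℚᵘ-fromℚᵘ (ℚᵘ.mkℚᵘ (ℤ.+ 1) m)) ⟩
    ℚᵘ.mkℚᵘ (ℤ.+ suc m) 0 ℚᵘ.* ℚᵘ.mkℚᵘ (ℤ.+ 1) m
      ≈⟨ ℚᵘ.*≡* (trans (ring (ℤ.+ suc m)) (cong (λ k → ℤ.+ 1 ℤ.* ℤ.+ k) (sym (*-identityˡ (suc m))))) ⟩
    ℚᵘ.1ℚᵘ
      ∎)
    where
    ring : ∀ x → x ℤ.* ℤ.+ 1 ℤ.* ℤ.+ 1 ≡ ℤ.+ 1 ℤ.* x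
    ring = ℤ-Solver.solve-∀

fromℕ-homo-+ : ∀ m n → fromℕ (m + n) ≡ fromℕ m ℚ.+ fromℕ n
fromℕ-homo-+ m n = fromℤ-homo-+ (ℤ.+ m) (ℤ.+ n)

fromℕ-homo-* : ∀ m n → fromℕ (m * n) ≡ fromℕ m ℚ.* fromℕ n
fromℕ-homo-* m n = trans (cong fromℤ (ℤₚ.pos-* m n)) (fromℤ-homo-* (ℤ.+ m) (ℤ.+ n))

invℕ-*-fromℕ : ∀ n → .{{NonZero n}} → invℕ n ℚ.* fromℕ n ≡ 1ℚ
invℕ-*-fromℕ n = trans (ℚₚ.*-comm (invℕ n) (fromℕ n)) (fromℕ-*-invℕ n)

*-cancelʳ-fromℕ : ∀ n → .{{NonZero n}} → ∀ {x y} → x ℚ.* fromℕ n ≡ y ℚ.* fromℕ n → x ≡ y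
*-cancelʳ-fromℕ n {x} {y} eq = begin
  x                          ≡⟨ ℚₚ.*-identityʳ x ⟨
  x ℚ.* 1ℚ                   ≡⟨ cong (x ℚ.*_) (fromℕ-*-invℕ n) ⟨
  x ℚ.* (fromℕ n ℚ.* invℕ n)  ≡⟨ ℚₚ.*-assoc x (fromℕ n) (invℕ n) ⟨
  x ℚ.* fromℕ n ℚ.* invℕ n    ≡⟨ cong (ℚ._* invℕ n) eq ⟩
  y ℚ.* fromℕ n ℚ.* invℕ n    ≡⟨ ℚₚ.*-assoc y (fromℕ n) (invℕ n) ⟩
  y ℚ.* (fromℕ n ℚ.* invℕ n)  ≡⟨ cong (y ℚ.*_) (fromℕ-*-invℕ n) ⟩
  y ℚ.* 1ℚ                   ≡⟨ ℚₚ.*-identityʳ y ⟩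
  y                          ∎
  where open ≡-Reasoning

pow₂ : ℕ → ℚ
pow₂ k = fromℕ (2 ^ k)

oddℚ : ℕ → ℚ
oddℚ t = fromℕ (suc (2 * t))

pow₂-+ : ∀ m n → pow₂ (m + n) ≡ pow₂ m ℚ.* pow₂ n
pow₂-+ m n = trans (cong fromℕ (^-distribˡ-+-* 2 m n)) (fromℕ-homo-* (2 ^ m) (2 ^ n))

pow₂-suc : ∀ n → pow₂ (suc n) ≡ pow₂ n ℚ.+ pow₂ n
pow₂-suc n = trans (fromℕ-homo-+ (2 ^ n) (2 ^ n + 0)) (cong (λ m → pow₂ n ℚ.+ fromℕ m) (+-identityʳ (2 ^ n)))

oddℚ-* : ∀ s t → oddℚ s ℚ.* oddℚ t ≡ oddℚ (2 * s * t + s + t)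
oddℚ-* s t = trans (sym (fromℕ-homo-* (suc (2 * s)) (suc (2 * t)))) (cong fromℕ (proj₂ (odd-* (s , refl) (t , refl))))

sumℚ≤-cong : ∀ n {g h} → (∀ j → j ≤ n → g j ≡ h j) → sumℚ≤ n g ≡ sumℚ≤ n h
sumℚ≤-cong zero    g≡h = g≡h 0 z≤n
sumℚ≤-cong (suc n) g≡h = cong₂ ℚ._+_ (sumℚ≤-cong n (λ j j≤n → g≡h j (m≤n⇒m≤1+n j≤n))) (g≡h (suc n) ≤-refl)

sumℚ≤-+ : ∀ n g h → sumℚ≤ n (λ j → g j ℚ.+ h j) ≡ sumℚ≤ n g ℚ.+ sumℚ≤ n h
sumℚ≤-+ zero    g h = refl
sumℚ≤-+ (suc n) g h = trans (cong (ℚ._+ (g (suc n) ℚ.+ h (suc n))) (sumℚ≤-+ n g h)) (interchange (sumℚ≤ n g) (sumℚ≤ n h) (g (suc n)) (h (suc n)))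
  where
  interchange : ∀ a b c d → a ℚ.+ b ℚ.+ (c ℚ.+ d) ≡ a ℚ.+ c ℚ.+ (b ℚ.+ d)
  interchange = solve-∀ ℚ-ring

sumℚ≤-*ˡ : ∀ n c g → sumℚ≤ n (λ j → c ℚ.* g j) ≡ c ℚ.* sumℚ≤ n g
sumℚ≤-*ˡ zero    c g = refl
sumℚ≤-*ˡ (suc n) c g = trans (cong (ℚ._+ (c ℚ.* g (suc n))) (sumℚ≤-*ˡ n c g)) (sym (ℚₚ.*-distribˡ-+ c (sumℚ≤ n g) (g (suc n))))

sumℚ≤-suc : ∀ n g → sumℚ≤ (suc n) g ≡ g 0 ℚ.+ sumℚ≤ n (λ j → g (suc j))
sumℚ≤-suc zero    g = refl
sumℚ≤-suc (suc n) g = trans (cong (ℚ._+ g (suc (suc n))) (sumℚ≤-suc n g)) (ℚₚ.+-assoc (g 0) (sumℚ≤ n (λ j → g (suc j))) (g (suc (suc n))))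

sumℚ< : ℕ → (ℕ → ℚ) → ℚ
sumℚ< zero    h = 0ℚ
sumℚ< (suc t) h = sumℚ< t h ℚ.+ h t

sumℚ<-+ : ∀ a b h → sumℚ< (a + b) h ≡ sumℚ< a h ℚ.+ sumℚ< b (λ i → h (a + i))
sumℚ<-+ a zero    h rewrite +-identityʳ a = sym (ℚₚ.+-identityʳ (sumℚ< a h))
sumℚ<-+ a (suc b) h rewrite +-suc a b =
  trans (cong (ℚ._+ h (a + b)) (sumℚ<-+ a b h)) (ℚₚ.+-assoc (sumℚ< a h) (sumℚ< b (λ i → h (a + i))) (h (a + b)))

sumℚ<-*ˡ : ∀ t c h → sumℚ< t (λ i → c ℚ.* h i) ≡ c ℚ.* sumℚ< t h
sumℚ<-*ˡ zero    c h = sym (ℚₚ.*-zeroʳ c)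
sumℚ<-*ˡ (suc t) c h = trans (cong (ℚ._+ (c ℚ.* h t)) (sumℚ<-*ˡ t c h)) (sym (ℚₚ.*-distribˡ-+ c (sumℚ< t h) (h t)))

sumℚ<-- : ∀ t g h → sumℚ< t (λ i → g i ℚ.- h i) ≡ sumℚ< t g ℚ.- sumℚ< t h
sumℚ<-- zero    g h = sym (ℚₚ.+-inverseʳ 0ℚ)
sumℚ<-- (suc t) g h = trans (cong (ℚ._+ (g t ℚ.- h t)) (sumℚ<-- t g h)) (interchange (sumℚ< t g) (sumℚ< t h) (g t) (h t))
  where
  interchange : ∀ a b c d → a ℚ.- b ℚ.+ (c ℚ.- d) ≡ a ℚ.+ c ℚ.- (b ℚ.+ d)
  interchange = solve-∀ ℚ-ring

invℕ-ratio : ∀ a c .{{_ : NonZero a}} .{{_ : NonZero c}} {m u} → a * u ≡ m * c → fromℕ m ℚ.* invℕ a ≡ fromℕ u ℚ.* invℕ c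
invℕ-ratio a c {m} {u} a*u≡m*c = begin
  fromℕ m ℚ.* invℕ a                                ≡⟨ ℚₚ.*-identityʳ _ ⟨
  fromℕ m ℚ.* invℕ a ℚ.* 1ℚ                         ≡⟨ cong (fromℕ m ℚ.* invℕ a ℚ.*_) (fromℕ-*-invℕ c) ⟨
  fromℕ m ℚ.* invℕ a ℚ.* (fromℕ c ℚ.* invℕ c)       ≡⟨ regroup (fromℕ m) (invℕ a) (fromℕ c) (invℕ c) ⟩
  fromℕ m ℚ.* fromℕ c ℚ.* invℕ a ℚ.* invℕ c         ≡⟨ cong (λ x → x ℚ.* invℕ a ℚ.* invℕ c) cross ⟩
  fromℕ a ℚ.* fromℕ u ℚ.* invℕ a ℚ.* invℕ c         ≡⟨ regroup′ (fromℕ a) (fromℕ u) (invℕ a) (invℕ c) ⟩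
  fromℕ u ℚ.* invℕ c ℚ.* (fromℕ a ℚ.* invℕ a)       ≡⟨ cong (fromℕ u ℚ.* invℕ c ℚ.*_) (fromℕ-*-invℕ a) ⟩
  fromℕ u ℚ.* invℕ c ℚ.* 1ℚ                         ≡⟨ ℚₚ.*-identityʳ _ ⟩
  fromℕ u ℚ.* invℕ c                                ∎
  where
  open ≡-Reasoning
  cross : fromℕ m ℚ.* fromℕ c ≡ fromℕ a ℚ.* fromℕ u
  cross = trans (sym (fromℕ-homo-* m c)) (trans (cong fromℕ (sym a*u≡m*c)) (fromℕ-homo-* a u))
  regroup : ∀ m i c j → m ℚ.* i ℚ.* (c ℚ.* j) ≡ m ℚ.* c ℚ.* i ℚ.* j
  regroup = solve-∀ ℚ-ring
  regroup′ : ∀ a u i j → a ℚ.* u ℚ.* i ℚ.* j ≡ u ℚ.* j ℚ.* (a ℚ.* i)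
  regroup′ = solve-∀ ℚ-ring

-- 2-adic valuation

-- v₂ q ≥ l ⊖ k  says  q ∈ 2^(l − k) ℤ₍₂₎, witnessed by  q · (2t+1) · 2^k = a · 2^l  with a ∈ ℤ;
-- keeping the exponent as a difference of naturals avoids integer exponents.
infix 4 v₂_≥_⊖_
record v₂_≥_⊖_ (q : ℚ) (l k : ℕ) : Set where
  constructor witness
  field
    numerator : ℤ
    oddIndex  : ℕ
    equation  : q ℚ.* oddℚ oddIndex ℚ.* pow₂ k ≡ fromℤ numerator ℚ.* pow₂ l

v₂-+ : ∀ {x y l k} → v₂ x ≥ l ⊖ k → v₂ y ≥ l ⊖ k → v₂ x ℚ.+ y ≥ l ⊖ k
v₂-+ {x} {y} {l} {k} (witness a s xs) (witness b t yt) = witness (a ℤ.* oddℤ t ℤ.+ b ℤ.* oddℤ s) (2 * s * t + s + t) (begin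
  (x ℚ.+ y) ℚ.* oddℚ (2 * s * t + s + t) ℚ.* pow₂ k  ≡⟨ cong (λ d → (x ℚ.+ y) ℚ.* d ℚ.* pow₂ k) (oddℚ-* s t) ⟨
  (x ℚ.+ y) ℚ.* (oddℚ s ℚ.* oddℚ t) ℚ.* pow₂ k        ≡⟨ distribute x y (oddℚ s) (oddℚ t) (pow₂ k) ⟩
  x ℚ.* oddℚ s ℚ.* pow₂ k ℚ.* oddℚ t ℚ.+ y ℚ.* oddℚ t ℚ.* pow₂ k ℚ.* oddℚ s
                                                  ≡⟨ cong₂ (λ u v → u ℚ.* oddℚ t ℚ.+ v ℚ.* oddℚ s) xs yt ⟩
  fromℤ a ℚ.* pow₂ l ℚ.* oddℚ t ℚ.+ fromℤ b ℚ.* pow₂ l ℚ.* oddℚ s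
                                                  ≡⟨ collect (fromℤ a) (fromℤ b) (oddℚ s) (oddℚ t) (pow₂ l) ⟩
  (fromℤ a ℚ.* oddℚ t ℚ.+ fromℤ b ℚ.* oddℚ s) ℚ.* pow₂ l
                                                  ≡⟨ cong (ℚ._* pow₂ l) (sym (trans (fromℤ-homo-+ (a ℤ.* oddℤ t) (b ℤ.* oddℤ s))
                                                       (cong₂ ℚ._+_ (fromℤ-homo-* a (oddℤ t)) (fromℤ-homo-* b (oddℤ s))))) ⟩
  fromℤ (a ℤ.* oddℤ t ℤ.+ b ℤ.* oddℤ s) ℚ.* pow₂ l  ∎)
  where
  open ≡-Reasoning
  oddℤ : ℕ → ℤ
  oddℤ t = ℤ.+ suc (2 * t)
  distribute : ∀ x y d e K → (x ℚ.+ y) ℚ.* (d ℚ.* e) ℚ.* K ≡ x ℚ.* d ℚ.* K ℚ.* e ℚ.+ y ℚ.* e ℚ.* K ℚ.* d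
  distribute = solve-∀ ℚ-ring
  collect : ∀ a b d e L → a ℚ.* L ℚ.* e ℚ.+ b ℚ.* L ℚ.* d ≡ (a ℚ.* e ℚ.+ b ℚ.* d) ℚ.* L
  collect = solve-∀ ℚ-ring

v₂-‿ : ∀ {x l k} → v₂ x ≥ l ⊖ k → v₂ ℚ.- x ≥ l ⊖ k
v₂-‿ {x} {l} {k} (witness a t xt) = witness (ℤ.- a) t (begin
  ℚ.- x ℚ.* oddℚ t ℚ.* pow₂ k     ≡⟨ negate-outside x (oddℚ t) (pow₂ k) ⟩
  ℚ.- (x ℚ.* oddℚ t ℚ.* pow₂ k)   ≡⟨ cong ℚ.-_ xt ⟩
  ℚ.- (fromℤ a ℚ.* pow₂ l)       ≡⟨ ℚₚ.neg-distribˡ-* (fromℤ a) (pow₂ l) ⟩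
  ℚ.- fromℤ a ℚ.* pow₂ l         ≡⟨ cong (ℚ._* pow₂ l) (fromℤ-homo-‿ a) ⟨
  fromℤ (ℤ.- a) ℚ.* pow₂ l       ∎)
  where
  open ≡-Reasoning
  negate-outside : ∀ x d K → ℚ.- x ℚ.* d ℚ.* K ≡ ℚ.- (x ℚ.* d ℚ.* K)
  negate-outside = solve-∀ ℚ-ring

v₂-- : ∀ {x y l k} → v₂ x ≥ l ⊖ k → v₂ y ≥ l ⊖ k → v₂ x ℚ.- y ≥ l ⊖ k
v₂-- vx vy = v₂-+ vx (v₂-‿ vy)

v₂-* : ∀ {x y l k l′ k′} → v₂ x ≥ l ⊖ k → v₂ y ≥ l′ ⊖ k′ → v₂ x ℚ.* y ≥ l + l′ ⊖ k + k′
v₂-* {x} {y} {l} {k} {l′} {k′} (witness a s xs) (witness b t yt) = witness (a ℤ.* b) (2 * s * t + s + t) (begin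
  x ℚ.* y ℚ.* oddℚ (2 * s * t + s + t) ℚ.* pow₂ (k + k′)
    ≡⟨ cong₂ (λ d K → x ℚ.* y ℚ.* d ℚ.* K) (sym (oddℚ-* s t)) (pow₂-+ k k′) ⟩
  x ℚ.* y ℚ.* (oddℚ s ℚ.* oddℚ t) ℚ.* (pow₂ k ℚ.* pow₂ k′)
    ≡⟨ regroup x y (oddℚ s) (oddℚ t) (pow₂ k) (pow₂ k′) ⟩
  (x ℚ.* oddℚ s ℚ.* pow₂ k) ℚ.* (y ℚ.* oddℚ t ℚ.* pow₂ k′)
    ≡⟨ cong₂ ℚ._*_ xs yt ⟩
  (fromℤ a ℚ.* pow₂ l) ℚ.* (fromℤ b ℚ.* pow₂ l′)
    ≡⟨ regroup′ (fromℤ a) (fromℤ b) (pow₂ l) (pow₂ l′) ⟩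
  fromℤ a ℚ.* fromℤ b ℚ.* (pow₂ l ℚ.* pow₂ l′)
    ≡⟨ cong₂ ℚ._*_ (fromℤ-homo-* a b) (pow₂-+ l l′) ⟨
  fromℤ (a ℤ.* b) ℚ.* pow₂ (l + l′) ∎)
  where
  open ≡-Reasoning
  regroup : ∀ x y d e K K′ → x ℚ.* y ℚ.* (d ℚ.* e) ℚ.* (K ℚ.* K′) ≡ (x ℚ.* d ℚ.* K) ℚ.* (y ℚ.* e ℚ.* K′)
  regroup = solve-∀ ℚ-ring
  regroup′ : ∀ a b L L′ → (a ℚ.* L) ℚ.* (b ℚ.* L′) ≡ a ℚ.* b ℚ.* (L ℚ.* L′)
  regroup′ = solve-∀ ℚ-ring

v₂-weaken : ∀ {x l k l′ k′} → l′ + k ≤ l + k′ → v₂ x ≥ l ⊖ k → v₂ x ≥ l′ ⊖ k′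
v₂-weaken {x} {l} {k} {l′} {k′} l′+k≤l+k′ (witness a t xt) with m≤n⇒∃[o]m+o≡n l′+k≤l+k′
... | d , l′+k+d≡l+k′ = witness (a ℤ.* ℤ.+ (2 ^ d)) t (*-cancelʳ-fromℕ (2 ^ k) {{m^n≢0 2 k}} (begin
  x ℚ.* oddℚ t ℚ.* pow₂ k′ ℚ.* pow₂ k              ≡⟨ swap x (oddℚ t) (pow₂ k′) (pow₂ k) ⟩
  x ℚ.* oddℚ t ℚ.* pow₂ k ℚ.* pow₂ k′              ≡⟨ cong (ℚ._* pow₂ k′) xt ⟩
  fromℤ a ℚ.* pow₂ l ℚ.* pow₂ k′                  ≡⟨ ℚₚ.*-assoc (fromℤ a) (pow₂ l) (pow₂ k′) ⟩
  fromℤ a ℚ.* (pow₂ l ℚ.* pow₂ k′)                ≡⟨ cong (fromℤ a ℚ.*_) (pow₂-+ l k′) ⟨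
  fromℤ a ℚ.* pow₂ (l + k′)                       ≡⟨ cong (λ e → fromℤ a ℚ.* pow₂ e) l′+k+d≡l+k′ ⟨
  fromℤ a ℚ.* pow₂ (l′ + k + d)                   ≡⟨ cong (fromℤ a ℚ.*_) (trans (pow₂-+ (l′ + k) d) (cong (ℚ._* pow₂ d) (pow₂-+ l′ k))) ⟩
  fromℤ a ℚ.* (pow₂ l′ ℚ.* pow₂ k ℚ.* pow₂ d)     ≡⟨ regroup (fromℤ a) (pow₂ l′) (pow₂ k) (pow₂ d) ⟩
  fromℤ a ℚ.* pow₂ d ℚ.* pow₂ l′ ℚ.* pow₂ k       ≡⟨ cong (λ c → c ℚ.* pow₂ l′ ℚ.* pow₂ k) (fromℤ-homo-* a (ℤ.+ (2 ^ d))) ⟨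
  fromℤ (a ℤ.* ℤ.+ (2 ^ d)) ℚ.* pow₂ l′ ℚ.* pow₂ k ∎))
  where
  open ≡-Reasoning
  swap : ∀ x d K′ K → x ℚ.* d ℚ.* K′ ℚ.* K ≡ x ℚ.* d ℚ.* K ℚ.* K′
  swap = solve-∀ ℚ-ring
  regroup : ∀ a L K D → a ℚ.* (L ℚ.* K ℚ.* D) ≡ a ℚ.* D ℚ.* L ℚ.* K
  regroup = solve-∀ ℚ-ring

v₂-fromℤ : ∀ a → v₂ fromℤ a ≥ 0 ⊖ 0
v₂-fromℤ a = witness a 0 (unit (fromℤ a))
  where
  unit : ∀ x → x ℚ.* 1ℚ ℚ.* 1ℚ ≡ x ℚ.* 1ℚ
  unit = solve-∀ ℚ-ring

v₂-fromℕ : ∀ n → v₂ fromℕ n ≥ 0 ⊖ 0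
v₂-fromℕ n = v₂-fromℤ (ℤ.+ n)

v₂-0 : ∀ {l k} → v₂ 0ℚ ≥ l ⊖ k
v₂-0 {l} {k} = witness (ℤ.+ 0) 0 (zeros (pow₂ k) (pow₂ l))
  where
  zeros : ∀ K L → 0ℚ ℚ.* 1ℚ ℚ.* K ≡ 0ℚ ℚ.* L
  zeros = solve-∀ ℚ-ring

v₂-pow₂ : ∀ j → v₂ pow₂ j ≥ j ⊖ 0
v₂-pow₂ j = witness (ℤ.+ 1) 0 (unit (pow₂ j))
  where
  unit : ∀ x → x ℚ.* 1ℚ ℚ.* 1ℚ ≡ 1ℚ ℚ.* x
  unit = solve-∀ ℚ-ring

v₂-invℕ : ∀ {n} v t → 2 ^ v * suc (2 * t) ≡ n → v₂ invℕ n ≥ 0 ⊖ v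
v₂-invℕ v t refl = witness (ℤ.+ 1) t (begin
  invℕ n ℚ.* oddℚ t ℚ.* pow₂ v    ≡⟨ ℚₚ.*-assoc (invℕ n) (oddℚ t) (pow₂ v) ⟩
  invℕ n ℚ.* (oddℚ t ℚ.* pow₂ v)  ≡⟨ cong (invℕ n ℚ.*_) (ℚₚ.*-comm (oddℚ t) (pow₂ v)) ⟩
  invℕ n ℚ.* (pow₂ v ℚ.* oddℚ t)  ≡⟨ cong (invℕ n ℚ.*_) (fromℕ-homo-* (2 ^ v) (suc (2 * t))) ⟨
  invℕ n ℚ.* fromℕ n             ≡⟨ invℕ-*-fromℕ n {{m*n≢0 (2 ^ v) (suc (2 * t)) {{m^n≢0 2 v}}}} ⟩
  1ℚ                             ∎)
  where
  open ≡-Reasoning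
  n = 2 ^ v * suc (2 * t)

v₂-sumℚ≤ : ∀ {l k} n g → (∀ j → j ≤ n → v₂ g j ≥ l ⊖ k) → v₂ sumℚ≤ n g ≥ l ⊖ k
v₂-sumℚ≤ zero    g vg = vg 0 z≤n
v₂-sumℚ≤ (suc n) g vg = v₂-+ (v₂-sumℚ≤ n g (λ j j≤n → vg j (m≤n⇒m≤1+n j≤n))) (vg (suc n) ≤-refl)

v₂-sumℚ< : ∀ {l k} t h → (∀ i → i < t → v₂ h i ≥ l ⊖ k) → v₂ sumℚ< t h ≥ l ⊖ k
v₂-sumℚ< zero    h vh = v₂-0
v₂-sumℚ< (suc t) h vh = v₂-+ (v₂-sumℚ< t h (λ i i<t → vh i (m<n⇒m<1+n i<t))) (vh t ≤-refl)

module _ where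
  open ℚᵘₚ.≃-Reasoning

  *-fromℤ⇒↥*≡*↧ : ∀ q c b → q ℚ.* fromℤ c ≡ fromℤ b → ↥ q ℤ.* c ≡ b ℤ.* ↧ q
  *-fromℤ⇒↥*≡*↧ q@(mkℚ n d _) c b eq =
    trans (ring n c) (trans (ℚᵘₚ.drop-*≡* unnormalised) (cong (λ m → b ℤ.* ℤ.+ m) (*-identityʳ (suc d))))
    where
    unnormalised : ℚᵘ.mkℚᵘ n d ℚᵘ.* ℚᵘ.mkℚᵘ c 0 ℚᵘ.≃ ℚᵘ.mkℚᵘ b 0
    unnormalised = begin
      ℚᵘ.mkℚᵘ n d ℚᵘ.* ℚᵘ.mkℚᵘ c 0   ≈⟨ ℚᵘₚ.*-congˡ {toℚᵘ q} (toℚᵘ-fromℤ c) ⟨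
      toℚᵘ q ℚᵘ.* toℚᵘ (fromℤ c)     ≈⟨ ℚₚ.toℚᵘ-homo-* q (fromℤ c) ⟨
      toℚᵘ (q ℚ.* fromℤ c)           ≈⟨ ℚₚ.toℚᵘ-cong eq ⟩
      toℚᵘ (fromℤ b)                 ≈⟨ toℚᵘ-fromℤ b ⟩
      ℚᵘ.mkℚᵘ b 0                    ∎
    ring : ∀ n c → n ℤ.* c ≡ n ℤ.* c ℤ.* ℤ.+ 1
    ring = ℤ-Solver.solve-∀

↧ₙ-coprime-∣↥∣ : ∀ q → Coprimality.Coprime (↧ₙ q) ∣ ↥ q ∣
↧ₙ-coprime-∣↥∣ (mkℚ _ _ coprime) = Coprimality.sym (Coprimality.recompute coprime)

v₂≥⇒TwoAdicSmall : ∀ {M q} → v₂ q ≥ M ⊖ 0 → TwoAdicSmall M q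
v₂≥⇒TwoAdicSmall {M} {q} (witness a t eq) = 2^M∣↥q , 2∤↧q
  where
  o = suc (2 * t)
  integral : ∣ ↥ q ∣ * o ≡ ∣ a ∣ * 2 ^ M * ↧ₙ q
  integral = begin
    ∣ ↥ q ∣ * o                      ≡⟨ ℤₚ.abs-* (↥ q) (ℤ.+ o) ⟨
    ∣ ↥ q ℤ.* ℤ.+ o ∣                ≡⟨ cong ∣_∣ (*-fromℤ⇒↥*≡*↧ q (ℤ.+ o) (a ℤ.* ℤ.+ (2 ^ M)) rational) ⟩
    ∣ a ℤ.* ℤ.+ (2 ^ M) ℤ.* ↧ q ∣    ≡⟨ ℤₚ.abs-* (a ℤ.* ℤ.+ (2 ^ M)) (↧ q) ⟩
    ∣ a ℤ.* ℤ.+ (2 ^ M) ∣ * ↧ₙ q     ≡⟨ cong (_* ↧ₙ q) (ℤₚ.abs-* a (ℤ.+ (2 ^ M))) ⟩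
    ∣ a ∣ * 2 ^ M * ↧ₙ q             ∎
    where
    open ≡-Reasoning
    rational : q ℚ.* oddℚ t ≡ fromℤ (a ℤ.* ℤ.+ (2 ^ M))
    rational = trans (sym (ℚₚ.*-identityʳ _)) (trans eq (sym (fromℤ-homo-* a (ℤ.+ (2 ^ M)))))
  2∤↧q : ¬ 2 ∣ ↧ₙ q
  2∤↧q 2∣↧q = 2∤odd t (∣-trans 2∣↧q ↧q∣o)
    where
    ↧q∣o : ↧ₙ q ∣ o
    ↧q∣o = Coprimality.coprime-divisor (↧ₙ-coprime-∣↥∣ q)
             (subst (↧ₙ q ∣_) (sym integral) (n∣m*n (∣ a ∣ * 2 ^ M)))
  2^M∣↥q : 2 ^ M ∣ ∣ ↥ q ∣
  2^M∣↥q = 2^∣*odd⇒2^∣ M ∣ ↥ q ∣ t (subst (2 ^ M ∣_) (sym integral) (∣m⇒∣m*n (↧ₙ q) (n∣m*n ∣ a ∣)))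

v₂-telescope : ∀ {M} (g : ℕ → ℚ) a₀ → (∀ a → a₀ ≤ a → v₂ g (suc a) ℚ.- g a ≥ M ⊖ 0) →
               ∀ b → a₀ ≤ b → v₂ g b ℚ.- g a₀ ≥ M ⊖ 0
v₂-telescope {M} g a₀ step b a₀≤b with m≤n⇒∃[o]m+o≡n a₀≤b
... | d , refl = from-a₀ d
  where
  from-a₀ : ∀ d → v₂ g (a₀ + d) ℚ.- g a₀ ≥ M ⊖ 0
  from-a₀ zero    rewrite +-identityʳ a₀ = subst (λ z → v₂ z ≥ M ⊖ 0) (sym (ℚₚ.+-inverseʳ (g a₀))) v₂-0
  from-a₀ (suc d) rewrite +-suc a₀ d =
    subst (λ z → v₂ z ≥ M ⊖ 0) (chain (g (suc (a₀ + d))) (g (a₀ + d)) (g a₀)) (v₂-+ (step (a₀ + d) (m≤m+n a₀ d)) (from-a₀ d))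
    where
    chain : ∀ x y z → (x ℚ.- y) ℚ.+ (y ℚ.- z) ≡ x ℚ.- z
    chain = solve-∀ ℚ-ring

v₂-differences : ∀ {M} (g : ℕ → ℚ) a₀ → (∀ a → a₀ ≤ a → v₂ g (suc a) ℚ.- g a ≥ M ⊖ 0) →
                 ∀ b c → a₀ ≤ b → a₀ ≤ c → v₂ g b ℚ.- g c ≥ M ⊖ 0
v₂-differences {M} g a₀ step b c a₀≤b a₀≤c =
  subst (λ z → v₂ z ≥ M ⊖ 0) (cancel (g b) (g c) (g a₀)) (v₂-- (v₂-telescope g a₀ step b a₀≤b) (v₂-telescope g a₀ step c a₀≤c))
  where
  cancel : ∀ x y z → (x ℚ.- z) ℚ.- (y ℚ.- z) ≡ x ℚ.- y
  cancel = solve-∀ ℚ-ring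

-- The recurrence of f

inverse-pascal : ∀ p j → j ≤ p →
  fromℕ (suc p) ℚ.* (invℕ (suc p C j) ℚ.+ invℕ (suc p C suc j)) ≡ fromℕ (suc (suc p)) ℚ.* invℕ (p C j)
inverse-pascal p j j≤p = begin
  fromℕ n ℚ.* (invℕ (n C j) ℚ.+ invℕ (n C suc j))
    ≡⟨ ℚₚ.*-distribˡ-+ (fromℕ n) _ _ ⟩
  fromℕ n ℚ.* invℕ (n C j) ℚ.+ fromℕ n ℚ.* invℕ (n C suc j)
    ≡⟨ cong₂ ℚ._+_ (invℕ-ratio (n C j) (p C j) {n} {n ∸ j} ratio₁) (invℕ-ratio (n C suc j) (p C j) {n} {suc j} ratio₂) ⟩
  fromℕ (n ∸ j) ℚ.* invℕ (p C j) ℚ.+ fromℕ (suc j) ℚ.* invℕ (p C j)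
    ≡⟨ ℚₚ.*-distribʳ-+ (invℕ (p C j)) (fromℕ (n ∸ j)) (fromℕ (suc j)) ⟨
  (fromℕ (n ∸ j) ℚ.+ fromℕ (suc j)) ℚ.* invℕ (p C j)
    ≡⟨ cong (ℚ._* invℕ (p C j)) (trans (sym (fromℕ-homo-+ (n ∸ j) (suc j))) (cong fromℕ n∸j+[1+j]≡1+n)) ⟩
  fromℕ (suc n) ℚ.* invℕ (p C j)
    ∎
  where
  open ≡-Reasoning
  n = suc p
  instance
    nCj≢0 : NonZero (n C j)
    nCj≢0 = >-nonZero (nCk>0 (m≤n⇒m≤1+n j≤p))
    nC[1+j]≢0 : NonZero (n C suc j)
    nC[1+j]≢0 = >-nonZero (nCk>0 (s≤s j≤p))
    pCj≢0 : NonZero (p C j)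
    pCj≢0 = >-nonZero (nCk>0 j≤p)
  ratio₂ : (n C suc j) * suc j ≡ n * (p C j)
  ratio₂ = [n+1]C[k+1]*[k+1]≡[n+1]*nCk p j
  ratio₁ : (n C j) * (n ∸ j) ≡ n * (p C j)
  ratio₁ = trans (sym (nC[k+1]*[k+1]≡nCk*[n∸k] n j)) ratio₂
  n∸j+[1+j]≡1+n : n ∸ j + suc j ≡ suc n
  n∸j+[1+j]≡1+n = trans (+-suc (n ∸ j) j) (cong suc (m∸n+n≡m (m≤n⇒m≤1+n j≤p)))

f-recurrence : ∀ p → fromℕ (suc p) ℚ.* (f (suc p) ℚ.+ f (suc p)) ≡ fromℕ (suc (suc p)) ℚ.* f p ℚ.+ (fromℕ (suc p) ℚ.+ fromℕ (suc p))
f-recurrence p = begin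
  N ℚ.* (f n ℚ.+ f n)                          ≡⟨ cong₂ (λ u w → N ℚ.* (u ℚ.+ w)) last-term-1 (sumℚ≤-suc p (λ j → invℕ (n C j))) ⟩
  N ℚ.* ((X ℚ.+ 1ℚ) ℚ.+ (1ℚ ℚ.+ Y))            ≡⟨ rearrange N X Y ⟩
  N ℚ.* (X ℚ.+ Y) ℚ.+ (N ℚ.+ N)                ≡⟨ cong (λ z → N ℚ.* z ℚ.+ (N ℚ.+ N)) (sumℚ≤-+ p _ _) ⟨
  N ℚ.* sumℚ≤ p (λ j → invℕ (n C j) ℚ.+ invℕ (n C suc j)) ℚ.+ (N ℚ.+ N)
                                               ≡⟨ cong (ℚ._+ (N ℚ.+ N)) (sumℚ≤-*ˡ p N _) ⟨
  sumℚ≤ p (λ j → N ℚ.* (invℕ (n C j) ℚ.+ invℕ (n C suc j))) ℚ.+ (N ℚ.+ N)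
                                               ≡⟨ cong (ℚ._+ (N ℚ.+ N)) (sumℚ≤-cong p (inverse-pascal p)) ⟩
  sumℚ≤ p (λ j → fromℕ (suc n) ℚ.* invℕ (p C j)) ℚ.+ (N ℚ.+ N)
                                               ≡⟨ cong (ℚ._+ (N ℚ.+ N)) (sumℚ≤-*ˡ p (fromℕ (suc n)) _) ⟩
  fromℕ (suc n) ℚ.* f p ℚ.+ (N ℚ.+ N)          ∎
  where
  open ≡-Reasoning
  n = suc p
  N = fromℕ n
  X = sumℚ≤ p (λ j → invℕ (n C j))
  Y = sumℚ≤ p (λ j → invℕ (n C suc j))
  last-term-1 : f n ≡ X ℚ.+ 1ℚ
  last-term-1 = cong (λ z → X ℚ.+ invℕ z) (nCn≡1 n)
  rearrange : ∀ N X Y → N ℚ.* ((X ℚ.+ 1ℚ) ℚ.+ (1ℚ ℚ.+ Y)) ≡ N ℚ.* (X ℚ.+ Y) ℚ.+ (N ℚ.+ N)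
  rearrange = solve-∀ ℚ-ring

increment : ℕ → ℕ → ℚ
increment s i = pow₂ (suc i) ℚ.* invℕ (suc (suc (s + i)))

increments : ℕ → ℕ → ℚ
increments s t = sumℚ< t (increment s)

-- By the recurrence, g(n) = 2ⁿ f(n)/(n+1) satisfies g(n) − g(n−1) = 2ⁿ/(n+1); this is
-- g(s+t) − g(s) = Σ_{i<t} 2^(s+i+1)/(s+i+2), multiplied by (s+1)/2^s.
f-telescoped : ∀ s t → fromℕ (suc (s + t)) ℚ.* (f s ℚ.+ fromℕ (suc s) ℚ.* increments s t) ≡ fromℕ (suc s) ℚ.* pow₂ t ℚ.* f (s + t)
f-telescoped s zero rewrite +-identityʳ s = unit (fromℕ (suc s)) (f s)
  where
  unit : ∀ S F → S ℚ.* (F ℚ.+ S ℚ.* 0ℚ) ≡ S ℚ.* 1ℚ ℚ.* F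
  unit = solve-∀ ℚ-ring
f-telescoped s (suc t) rewrite +-suc s t = *-cancelʳ-fromℕ (suc p) (begin
  fromℕ (2 + p) ℚ.* (f s ℚ.+ S ℚ.* (increments s t ℚ.+ pow₂ (suc t) ℚ.* invℕ (2 + p))) ℚ.* fromℕ (suc p)
    ≡⟨ cong (λ z → fromℕ (2 + p) ℚ.* (f s ℚ.+ S ℚ.* (increments s t ℚ.+ z ℚ.* invℕ (2 + p))) ℚ.* fromℕ (suc p)) (pow₂-suc t) ⟩
  fromℕ (2 + p) ℚ.* (f s ℚ.+ S ℚ.* (increments s t ℚ.+ (Q ℚ.+ Q) ℚ.* invℕ (2 + p))) ℚ.* fromℕ (suc p)
    ≡⟨ expand (fromℕ (2 + p)) (f s) S (increments s t) Q (invℕ (2 + p)) (fromℕ (suc p)) ⟩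
  fromℕ (2 + p) ℚ.* (fromℕ (suc p) ℚ.* (f s ℚ.+ S ℚ.* increments s t))
    ℚ.+ fromℕ (suc p) ℚ.* S ℚ.* (Q ℚ.+ Q) ℚ.* (fromℕ (2 + p) ℚ.* invℕ (2 + p))
    ≡⟨ cong₂ (λ x y → fromℕ (2 + p) ℚ.* x ℚ.+ fromℕ (suc p) ℚ.* S ℚ.* (Q ℚ.+ Q) ℚ.* y) (f-telescoped s t) (fromℕ-*-invℕ (2 + p)) ⟩
  fromℕ (2 + p) ℚ.* (S ℚ.* Q ℚ.* f p) ℚ.+ fromℕ (suc p) ℚ.* S ℚ.* (Q ℚ.+ Q) ℚ.* 1ℚ
    ≡⟨ factor (fromℕ (2 + p)) S Q (f p) (fromℕ (suc p)) ⟩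
  S ℚ.* Q ℚ.* (fromℕ (2 + p) ℚ.* f p ℚ.+ (fromℕ (suc p) ℚ.+ fromℕ (suc p)))
    ≡⟨ cong (S ℚ.* Q ℚ.*_) (f-recurrence p) ⟨
  S ℚ.* Q ℚ.* (fromℕ (suc p) ℚ.* (f (suc p) ℚ.+ f (suc p)))
    ≡⟨ regroup S Q (fromℕ (suc p)) (f (suc p)) ⟩
  S ℚ.* (Q ℚ.+ Q) ℚ.* f (suc p) ℚ.* fromℕ (suc p)
    ≡⟨ cong (λ z → S ℚ.* z ℚ.* f (suc p) ℚ.* fromℕ (suc p)) (pow₂-suc t) ⟨
  S ℚ.* pow₂ (suc t) ℚ.* f (suc p) ℚ.* fromℕ (suc p) ∎)
  where
  open ≡-Reasoning
  p = s + t
  S = fromℕ (suc s)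
  Q = pow₂ t
  expand : ∀ N F S W Q i N′ →
    N ℚ.* (F ℚ.+ S ℚ.* (W ℚ.+ (Q ℚ.+ Q) ℚ.* i)) ℚ.* N′ ≡ N ℚ.* (N′ ℚ.* (F ℚ.+ S ℚ.* W)) ℚ.+ N′ ℚ.* S ℚ.* (Q ℚ.+ Q) ℚ.* (N ℚ.* i)
  expand = solve-∀ ℚ-ring
  factor : ∀ N S Q F N′ → N ℚ.* (S ℚ.* Q ℚ.* F) ℚ.+ N′ ℚ.* S ℚ.* (Q ℚ.+ Q) ℚ.* 1ℚ ≡ S ℚ.* Q ℚ.* (N ℚ.* F ℚ.+ (N′ ℚ.+ N′))
  factor = solve-∀ ℚ-ring
  regroup : ∀ S Q N F → S ℚ.* Q ℚ.* (N ℚ.* (F ℚ.+ F)) ≡ S ℚ.* (Q ℚ.+ Q) ℚ.* F ℚ.* N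
  regroup = solve-∀ ℚ-ring

f-solved : ∀ s t → f s ≡ fromℕ (suc s) ℚ.* pow₂ t ℚ.* f (s + t) ℚ.* invℕ (suc (s + t)) ℚ.- fromℕ (suc s) ℚ.* increments s t
f-solved s t = begin
  f s                                    ≡⟨ unit (f s) X ⟩
  (f s ℚ.+ X) ℚ.* 1ℚ ℚ.- X               ≡⟨ cong (λ z → (f s ℚ.+ X) ℚ.* z ℚ.- X) (fromℕ-*-invℕ (suc (s + t))) ⟨
  (f s ℚ.+ X) ℚ.* (N ℚ.* invℕ (suc (s + t))) ℚ.- X  ≡⟨ regroup (f s) X N (invℕ (suc (s + t))) ⟩
  N ℚ.* (f s ℚ.+ X) ℚ.* invℕ (suc (s + t)) ℚ.- X    ≡⟨ cong (λ z → z ℚ.* invℕ (suc (s + t)) ℚ.- X) (f-telescoped s t) ⟩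
  fromℕ (suc s) ℚ.* pow₂ t ℚ.* f (s + t) ℚ.* invℕ (suc (s + t)) ℚ.- X ∎
  where
  open ≡-Reasoning
  N = fromℕ (suc (s + t))
  X = fromℕ (suc s) ℚ.* increments s t
  unit : ∀ F X → F ≡ (F ℚ.+ X) ℚ.* 1ℚ ℚ.- X
  unit = solve-∀ ℚ-ring
  regroup : ∀ F X N i → (F ℚ.+ X) ℚ.* (N ℚ.* i) ℚ.- X ≡ N ℚ.* (F ℚ.+ X) ℚ.* i ℚ.- X
  regroup = solve-∀ ℚ-ring

v₂-f[2^r∸1] : ∀ r {q} → suc q ≡ 2 ^ r → v₂ f q ≥ 0 ⊖ 0
v₂-f[2^r∸1] r {q} 1+q≡2^r = v₂-sumℚ≤ q (λ j → invℕ (q C j)) (λ j j≤q → v₂-invℕ-odd ([2^r∸1]Ck-odd r 1+q≡2^r j j≤q))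
  where
  v₂-invℕ-odd : ∀ {n} → Odd n → v₂ invℕ n ≥ 0 ⊖ 0
  v₂-invℕ-odd (t , refl) = v₂-invℕ 0 t (+-identityʳ _)

-- The increment f(s + 2^E) − f(s)

main-term : ℕ → ℕ → ℚ
main-term s t = fromℕ (suc s) ℚ.* pow₂ t ℚ.* f (s + t) ℚ.* invℕ (suc (s + t))

v₂-main-term : ∀ {M r} s t → suc (s + t) ≡ 2 ^ r → M + r ≤ t → v₂ main-term s t ≥ M ⊖ 0
v₂-main-term {M} {r} s t 1+s+t≡2^r M+r≤t =
  v₂-weaken (≤-trans M+r≤t (≤-reflexive (sym (pad t))))
    (v₂-* (v₂-* (v₂-* (v₂-fromℕ (suc s)) (v₂-pow₂ t)) (v₂-f[2^r∸1] r 1+s+t≡2^r))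
          (v₂-invℕ r 0 (trans (*-identityʳ (2 ^ r)) (sym 1+s+t≡2^r))))
  where
  pad : ∀ t → t + 0 + 0 + 0 ≡ t
  pad = ℕ-Solver.solve-∀

-- The numerators cancel up to 2^E: (s+1)(y+2^E) − (s+1+2^E)y = −2^E(i+1), where y = s+i+2.
increment-difference : ∀ s E i →
  fromℕ (suc s) ℚ.* increment s i ℚ.- fromℕ (suc (s + 2 ^ E)) ℚ.* increment (s + 2 ^ E) i ≡
  ℚ.- (pow₂ (suc i) ℚ.* (pow₂ E ℚ.* fromℕ (suc i) ℚ.* invℕ (suc (suc (s + i))) ℚ.* invℕ (suc (suc (s + 2 ^ E + i)))))
increment-difference s E i = begin
  S ℚ.* (Q ℚ.* iy) ℚ.- S′ ℚ.* (Q ℚ.* iy′)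
    ≡⟨ cong (λ z → S ℚ.* (Q ℚ.* iy) ℚ.- z ℚ.* (Q ℚ.* iy′)) (fromℕ-homo-+ (suc s) (2 ^ E)) ⟩
  S ℚ.* (Q ℚ.* iy) ℚ.- (S ℚ.+ P) ℚ.* (Q ℚ.* iy′)
    ≡⟨ units S P Q iy iy′ ⟩
  S ℚ.* (Q ℚ.* iy) ℚ.* 1ℚ ℚ.- (S ℚ.+ P) ℚ.* (Q ℚ.* iy′) ℚ.* 1ℚ
    ≡⟨ cong₂ (λ a b → S ℚ.* (Q ℚ.* iy) ℚ.* a ℚ.- (S ℚ.+ P) ℚ.* (Q ℚ.* iy′) ℚ.* b) y′*iy′≡1 y*iy≡1 ⟨
  S ℚ.* (Q ℚ.* iy) ℚ.* ((S ℚ.+ I ℚ.+ P) ℚ.* iy′) ℚ.- (S ℚ.+ P) ℚ.* (Q ℚ.* iy′) ℚ.* ((S ℚ.+ I) ℚ.* iy)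
    ≡⟨ cross-terms S I P Q iy iy′ ⟩
  ℚ.- (Q ℚ.* (P ℚ.* I ℚ.* iy ℚ.* iy′)) ∎
  where
  open ≡-Reasoning
  S  = fromℕ (suc s)
  S′ = fromℕ (suc (s + 2 ^ E))
  P  = pow₂ E
  I  = fromℕ (suc i)
  Q  = pow₂ (suc i)
  iy  = invℕ (suc (suc (s + i)))
  iy′ = invℕ (suc (suc (s + 2 ^ E + i)))
  y*iy≡1 : (S ℚ.+ I) ℚ.* iy ≡ 1ℚ
  y*iy≡1 = trans (cong (ℚ._* iy) (sym (trans (cong fromℕ (cong suc (sym (+-suc s i)))) (fromℕ-homo-+ (suc s) (suc i)))))
                 (fromℕ-*-invℕ (suc (suc (s + i))))
  y′*iy′≡1 : (S ℚ.+ I ℚ.+ P) ℚ.* iy′ ≡ 1ℚ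
  y′*iy′≡1 = trans (cong (ℚ._* iy′) (sym (trans (cong fromℕ (regroup s i (2 ^ E)))
                                                (trans (fromℕ-homo-+ (suc s + suc i) (2 ^ E)) (cong (ℚ._+ P) (fromℕ-homo-+ (suc s) (suc i)))))))
                   (fromℕ-*-invℕ (suc (suc (s + 2 ^ E + i))))
    where
    regroup : ∀ s i P → suc (suc (s + P + i)) ≡ suc s + suc i + P
    regroup = ℕ-Solver.solve-∀
  units : ∀ S P Q iy iy′ →
    S ℚ.* (Q ℚ.* iy) ℚ.- (S ℚ.+ P) ℚ.* (Q ℚ.* iy′) ≡ S ℚ.* (Q ℚ.* iy) ℚ.* 1ℚ ℚ.- (S ℚ.+ P) ℚ.* (Q ℚ.* iy′) ℚ.* 1ℚ
  units = solve-∀ ℚ-ring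
  cross-terms : ∀ S I P Q iy iy′ →
    S ℚ.* (Q ℚ.* iy) ℚ.* ((S ℚ.+ I ℚ.+ P) ℚ.* iy′) ℚ.- (S ℚ.+ P) ℚ.* (Q ℚ.* iy′) ℚ.* ((S ℚ.+ I) ℚ.* iy)
      ≡ ℚ.- (Q ℚ.* (P ℚ.* I ℚ.* iy ℚ.* iy′))
  cross-terms = solve-∀ ℚ-ring

-- t₁ and t₂ are chosen so that s + t₁ = (s + 2^E) + t₂ = 2^(E+1) − 1.
module _ (M s E : ℕ) (M+s+3≤E : M + s + 3 ≤ E) where
  private
    s′ = s + 2 ^ E
    S  = fromℕ (suc s)
    S′ = fromℕ (suc s′)
    t₂ = 2 ^ E ∸ suc s
    t₁ = t₂ + 2 ^ E

    M+s+2≤E : M + s + 2 ≤ E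
    M+s+2≤E = ≤-trans (n≤1+n (M + s + 2)) (subst (_≤ E) (+-suc (M + s) 2) M+s+3≤E)

    2E≤2^E : E + E ≤ 2 ^ E
    2E≤2^E = subst (_≤ 2 ^ E) (cong (E +_) (+-identityʳ E)) (2*n≤2^n E)

    1+s≤2^E : suc s ≤ 2 ^ E
    1+s≤2^E = begin
      suc s            ≤⟨ m≤n+m (suc s) (M + 1) ⟩
      M + 1 + suc s    ≡⟨ shift M s ⟩
      M + s + 2        ≤⟨ M+s+2≤E ⟩
      E                ≤⟨ m≤m+n E E ⟩
      E + E            ≤⟨ 2E≤2^E ⟩
      2 ^ E            ∎
      where
      open ≤-Reasoning
      shift : ∀ M s → M + 1 + suc s ≡ M + s + 2
      shift = ℕ-Solver.solve-∀

    1+s+t₂≡2^E : suc s + t₂ ≡ 2 ^ E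
    1+s+t₂≡2^E = m+[n∸m]≡n 1+s≤2^E

    M+[1+E]≤t₂ : M + suc E ≤ t₂
    M+[1+E]≤t₂ = +-cancelˡ-≤ (suc s) (M + suc E) t₂ (begin
      suc s + (M + suc E)   ≡⟨ shift M s E ⟩
      M + s + 2 + E         ≤⟨ +-monoˡ-≤ E M+s+2≤E ⟩
      E + E                 ≤⟨ 2E≤2^E ⟩
      2 ^ E                 ≡⟨ 1+s+t₂≡2^E ⟨
      suc s + t₂            ∎)
      where
      open ≤-Reasoning
      shift : ∀ M s E → suc s + (M + suc E) ≡ M + s + 2 + E
      shift = ℕ-Solver.solve-∀

    1+s+t₁≡2^[1+E] : suc (s + t₁) ≡ 2 ^ suc E
    1+s+t₁≡2^[1+E] = trans (regroup s t₂ (2 ^ E)) (trans (cong (_+ 2 ^ E) 1+s+t₂≡2^E) (cong (2 ^ E +_) (sym (+-identityʳ (2 ^ E)))))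
      where
      regroup : ∀ s t P → suc (s + (t + P)) ≡ suc s + t + P
      regroup = ℕ-Solver.solve-∀

    1+s′+t₂≡2^[1+E] : suc (s′ + t₂) ≡ 2 ^ suc E
    1+s′+t₂≡2^[1+E] = trans (cong suc (regroup s t₂ (2 ^ E))) 1+s+t₁≡2^[1+E]
      where
      regroup : ∀ s t P → s + P + t ≡ s + (t + P)
      regroup = ℕ-Solver.solve-∀

    pair-terms : ℚ
    pair-terms = sumℚ< t₂ (λ i → S ℚ.* increment s i ℚ.- S′ ℚ.* increment s′ i)

    tail-terms : ℚ
    tail-terms = sumℚ< (2 ^ E) (λ i → S ℚ.* increment s (t₂ + i))

    difference-split : f s′ ℚ.- f s ≡ (main-term s′ t₂ ℚ.- main-term s t₁) ℚ.+ (pair-terms ℚ.+ tail-terms)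
    difference-split = begin
      f s′ ℚ.- f s                                 ≡⟨ cong₂ ℚ._-_ (f-solved s′ t₂) (f-solved s t₁) ⟩
      (A′ ℚ.- S′ ℚ.* increments s′ t₂) ℚ.- (A ℚ.- S ℚ.* increments s t₁)
                                                   ≡⟨ cong (λ z → (A′ ℚ.- S′ ℚ.* increments s′ t₂) ℚ.- (A ℚ.- S ℚ.* z)) (sumℚ<-+ t₂ (2 ^ E) (increment s)) ⟩
      (A′ ℚ.- S′ ℚ.* increments s′ t₂) ℚ.- (A ℚ.- S ℚ.* (increments s t₂ ℚ.+ sumℚ< (2 ^ E) (λ i → increment s (t₂ + i))))
                                                   ≡⟨ rearrange A′ A S S′ (increments s t₂) (increments s′ t₂) _ ⟩
      (A′ ℚ.- A) ℚ.+ ((S ℚ.* increments s t₂ ℚ.- S′ ℚ.* increments s′ t₂) ℚ.+ S ℚ.* sumℚ< (2 ^ E) (λ i → increment s (t₂ + i)))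
                                                   ≡⟨ cong₂ (λ x y → (A′ ℚ.- A) ℚ.+ (x ℚ.+ y)) pair-terms≡ tail-terms≡ ⟨
      (A′ ℚ.- A) ℚ.+ (pair-terms ℚ.+ tail-terms)   ∎
      where
      open ≡-Reasoning
      A  = main-term s t₁
      A′ = main-term s′ t₂
      rearrange : ∀ A′ A S S′ W W′ T →
        (A′ ℚ.- S′ ℚ.* W′) ℚ.- (A ℚ.- S ℚ.* (W ℚ.+ T)) ≡ (A′ ℚ.- A) ℚ.+ ((S ℚ.* W ℚ.- S′ ℚ.* W′) ℚ.+ S ℚ.* T)
      rearrange = solve-∀ ℚ-ring
      pair-terms≡ : pair-terms ≡ S ℚ.* increments s t₂ ℚ.- S′ ℚ.* increments s′ t₂
      pair-terms≡ = trans (sumℚ<-- t₂ _ _) (cong₂ ℚ._-_ (sumℚ<-*ˡ t₂ S (increment s)) (sumℚ<-*ˡ t₂ S′ (increment s′)))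
      tail-terms≡ : tail-terms ≡ S ℚ.* sumℚ< (2 ^ E) (λ i → increment s (t₂ + i))
      tail-terms≡ = sumℚ<-*ˡ (2 ^ E) S (λ i → increment s (t₂ + i))

    v₂-pair-term : ∀ i → i < t₂ → v₂ S ℚ.* increment s i ℚ.- S′ ℚ.* increment s′ i ≥ M ⊖ 0
    v₂-pair-term i i<t₂ with pow₂*odd-decomposition (suc (s + i)) | pow₂*odd-decomposition (suc (s′ + i))
    ... | e₁ , u₁ , 2^e₁*o≡y | e₂ , u₂ , 2^e₂*o≡y′ =
      subst (λ z → v₂ z ≥ M ⊖ 0) (sym (increment-difference s E i))
        (v₂-‿ (v₂-weaken M+e₁+e₂≤1+i+E
          (v₂-* (v₂-pow₂ (suc i))
                (v₂-* (v₂-* (v₂-* (v₂-pow₂ E) (v₂-fromℕ (suc i))) (v₂-invℕ e₁ u₁ 2^e₁*o≡y)) (v₂-invℕ e₂ u₂ 2^e₂*o≡y′)))))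
      where
      y = suc (suc (s + i))
      y≤2^E : y ≤ 2 ^ E
      y≤2^E = subst₂ _≤_ (cong suc (+-suc s i)) 1+s+t₂≡2^E (+-monoʳ-≤ (suc s) i<t₂)
      2^e₂*o≡2^E+y : 2 ^ e₂ * suc (2 * u₂) ≡ 2 ^ E + y
      2^e₂*o≡2^E+y = trans 2^e₂*o≡y′ (regroup s i (2 ^ E))
        where
        regroup : ∀ s i P → suc (suc (s + P + i)) ≡ P + suc (suc (s + i))
        regroup = ℕ-Solver.solve-∀
      M+e₁+e₂≤1+i+E : M + (e₁ + e₂) ≤ suc i + (E + 0 + 0 + 0) + 0
      M+e₁+e₂≤1+i+E = begin
        M + (e₁ + e₂)                 ≤⟨ +-monoʳ-≤ M (exponent-sum-bound e₁ e₂ (subst (2 ^ e₁ ≤_) 2^e₁*o≡y (m≤m*n (2 ^ e₁) (suc (2 * u₁))))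
                                                                         (2^e∣2^E+y⇒2^e≤2*y e₂ E z<s y≤2^E 2^e₂*o≡2^E+y)) ⟩
        M + suc y                     ≡⟨ regroup M s i ⟩
        M + s + 2 + suc i             ≤⟨ +-monoˡ-≤ (suc i) M+s+2≤E ⟩
        E + suc i                     ≡⟨ pad E i ⟩
        suc i + (E + 0 + 0 + 0) + 0   ∎
        where
        open ≤-Reasoning
        regroup : ∀ M s i → M + suc (suc (suc (s + i))) ≡ M + s + 2 + suc i
        regroup = ℕ-Solver.solve-∀
        pad : ∀ E i → E + suc i ≡ suc i + (E + 0 + 0 + 0) + 0
        pad = ℕ-Solver.solve-∀

    v₂-tail-term : ∀ i → i < 2 ^ E → v₂ S ℚ.* increment s (t₂ + i) ≥ M ⊖ 0
    v₂-tail-term i i<2^E with pow₂*odd-decomposition (suc (s + (t₂ + i)))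
    ... | e , u , 2^e*o≡n =
      v₂-weaken M+e≤1+j (v₂-* (v₂-fromℕ (suc s)) (v₂-* (v₂-pow₂ (suc (t₂ + i))) (v₂-invℕ e u 2^e*o≡n)))
      where
      n≤2^[1+E] : suc (suc (s + (t₂ + i))) ≤ 2 ^ suc E
      n≤2^[1+E] = subst₂ _≤_ (trans (cong (_+ suc i) (sym 1+s+t₂≡2^E)) (regroup s t₂ i)) (cong (2 ^ E +_) (sym (+-identityʳ (2 ^ E))))
                    (+-monoʳ-≤ (2 ^ E) i<2^E)
        where
        regroup : ∀ s t i → suc s + t + suc i ≡ suc (suc (s + (t + i)))
        regroup = ℕ-Solver.solve-∀
      e≤1+E : e ≤ suc E
      e≤1+E = ^-cancelʳ-≤ 2 (s≤s (s≤s z≤n)) (≤-trans (subst (2 ^ e ≤_) 2^e*o≡n (m≤m*n (2 ^ e) (suc (2 * u)))) n≤2^[1+E])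
      M+e≤1+j : M + e ≤ suc (t₂ + i) + 0 + 0
      M+e≤1+j = begin
        M + e                  ≤⟨ +-monoʳ-≤ M e≤1+E ⟩
        M + suc E              ≤⟨ M+[1+E]≤t₂ ⟩
        t₂                     ≤⟨ m≤m+n t₂ i ⟩
        t₂ + i                 ≤⟨ n≤1+n (t₂ + i) ⟩
        suc (t₂ + i)           ≡⟨ pad (suc (t₂ + i)) ⟨
        suc (t₂ + i) + 0 + 0   ∎
        where
        open ≤-Reasoning
        pad : ∀ n → n + 0 + 0 ≡ n
        pad = ℕ-Solver.solve-∀

  v₂[f[s+2^E]-f[s]]≥M : v₂ f (s + 2 ^ E) ℚ.- f s ≥ M ⊖ 0
  v₂[f[s+2^E]-f[s]]≥M = subst (λ z → v₂ z ≥ M ⊖ 0) (sym difference-split)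
    (v₂-+ (v₂-- (v₂-main-term s′ t₂ 1+s′+t₂≡2^[1+E] M+[1+E]≤t₂)
                (v₂-main-term s t₁ 1+s+t₁≡2^[1+E] (≤-trans M+[1+E]≤t₂ (m≤m+n t₂ (2 ^ E)))))
          (v₂-+ (v₂-sumℚ< t₂ _ v₂-pair-term) (v₂-sumℚ< (2 ^ E) _ v₂-tail-term)))

-- The sequence f(x_n)

sumℕ≤≡sumℕ< : ∀ n g → sumℕ≤ n g ≡ sumℕ< (suc n) g
sumℕ≤≡sumℕ< zero    g = refl
sumℕ≤≡sumℕ< (suc n) g = cong (_+ g (suc n)) (sumℕ≤≡sumℕ< n g)

prefix : (ℕ → ℕ) → ℕ → ℕ
prefix e k = sumℕ< k (λ i → 2 ^ e i)

module _ (e : ℕ → ℕ) (e-inc : StrictlyIncreasing e) where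

  e-mono-< : ∀ {i j} → i < j → e i < e j
  e-mono-< {i} (s≤s i≤j′) with m≤n⇒∃[o]m+o≡n i≤j′
  ... | d , refl = from-i d
    where
    from-i : ∀ d → e i < e (suc (i + d))
    from-i zero    rewrite +-identityʳ i = e-inc i
    from-i (suc d) rewrite +-suc i d = <-trans (from-i d) (e-inc (suc (i + d)))

  e-mono-≤ : ∀ {i j} → i ≤ j → e i ≤ e j
  e-mono-≤ i≤j with m≤n⇒m<n∨m≡n i≤j
  ... | inj₁ i<j  = <⇒≤ (e-mono-< i<j)
  ... | inj₂ refl = ≤-refl

  k≤e[k] : ∀ k → k ≤ e k
  k≤e[k] zero    = z≤n
  k≤e[k] (suc k) = ≤-trans (s≤s (k≤e[k] k)) (e-inc k)

  hitsUpTo-true : ∀ {i k} K → k ≤ K → e k ≡ i → hitsUpTo e i K ≡ true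
  hitsUpTo-true {i} {k} K k≤K e[k]≡i with m≤n⇒m<n∨m≡n k≤K
  hitsUpTo-true (suc K) _ e[k]≡i | inj₁ (s≤s k≤K) rewrite hitsUpTo-true K k≤K e[k]≡i = refl
  hitsUpTo-true {i} zero    _ e[k]≡i | inj₂ refl = trans (isYes≗does (e 0 ≟ i)) (dec-true (e 0 ≟ i) e[k]≡i)
  hitsUpTo-true {i} (suc K) _ e[k]≡i | inj₂ refl =
    trans (cong (hitsUpTo e i K ∨_) (trans (isYes≗does (e (suc K) ≟ i)) (dec-true (e (suc K) ≟ i) e[k]≡i))) (∨-zeroʳ (hitsUpTo e i K))

  hitsUpTo-false : ∀ {i} K → (∀ k → e k ≢ i) → hitsUpTo e i K ≡ false
  hitsUpTo-false {i} zero    miss = trans (isYes≗does (e 0 ≟ i)) (dec-false (e 0 ≟ i) (miss 0))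
  hitsUpTo-false {i} (suc K) miss rewrite hitsUpTo-false K miss = trans (isYes≗does (e (suc K) ≟ i)) (dec-false (e (suc K) ≟ i) (miss (suc K)))

  digit-hit : ∀ {k i} → e k ≡ i → digit e i ≡ 1
  digit-hit {k} {i} e[k]≡i rewrite hitsUpTo-true i (subst (k ≤_) e[k]≡i (k≤e[k] k)) e[k]≡i = refl

  digit-miss : ∀ {i} → (∀ k → e k ≢ i) → digit e i ≡ 0
  digit-miss {i} miss rewrite hitsUpTo-false i miss = refl

  digits : ℕ → ℕ
  digits m = sumℕ< m (λ i → digit e i * 2 ^ i)

  -- After the binary digits below m, exactly the first k terms 2^(e i) have been seen.
  SplitAt : ℕ → ℕ → Set
  SplitAt m k = (digits m ≡ prefix e k) × (∀ i → i < k → e i < m) × (m ≤ e k)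

  split : ∀ m → Σ ℕ (SplitAt m)
  split zero = 0 , refl , (λ _ ()) , z≤n
  split (suc m) with split m
  ... | k , sum≡prefix , below , m≤e[k] with m≤n⇒m<n∨m≡n m≤e[k]
  ...   | inj₂ m≡e[k] = suc k , cong₂ _+_ sum≡prefix new-term , below′ , subst (_< e (suc k)) (sym m≡e[k]) (e-inc k)
    where
    new-term : digit e m * 2 ^ m ≡ 2 ^ e k
    new-term = trans (cong (_* 2 ^ m) (digit-hit (sym m≡e[k]))) (trans (*-identityˡ (2 ^ m)) (cong (2 ^_) m≡e[k]))
    below′ : ∀ i → i < suc k → e i < suc m
    below′ i (s≤s i≤k) with m≤n⇒m<n∨m≡n i≤k
    ... | inj₁ i<k  = m<n⇒m<1+n (below i i<k)
    ... | inj₂ refl = s≤s (≤-reflexive (sym m≡e[k]))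
  ...   | inj₁ m<e[k] =
    k , trans (cong (digits m +_) no-term) (trans (+-identityʳ (digits m)) sum≡prefix) , (λ i i<k → m<n⇒m<1+n (below i i<k)) , m<e[k]
    where
    miss : ∀ j → e j ≢ m
    miss j e[j]≡m with <-cmp j k
    ... | tri< j<k _ _  = <-irrefl e[j]≡m (below j j<k)
    ... | tri≈ _ refl _ = <-irrefl (sym e[j]≡m) m<e[k]
    ... | tri> _ _ k<j  = <-irrefl (sym e[j]≡m) (<-trans m<e[k] (e-mono-< k<j))
    no-term : digit e m * 2 ^ m ≡ 0
    no-term = cong (_* 2 ^ m) (digit-miss miss)

  partial-beyond : ∀ a {n} → e a ≤ n → Σ ℕ λ k → (a ≤ k) × (partial e n ≡ prefix e k)
  partial-beyond a {n} e[a]≤n with split (suc n)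
  ... | k , sum≡prefix , _ , n<e[k] = k , ≮⇒≥ k≮a , trans (sumℕ≤≡sumℕ< n _) sum≡prefix
    where
    k≮a : ¬ k < a
    k≮a k<a = <-irrefl refl (<-≤-trans n<e[k] (≤-trans (e-mono-≤ (<⇒≤ k<a)) e[a]≤n))

  v₂-f∘prefix-increment : ∀ N M → (∀ k → N ≤ k → k + prefix e k < e k) →
                          ∀ a → N + (M + 2) ≤ a → v₂ f (prefix e (suc a)) ℚ.- f (prefix e a) ≥ M ⊖ 0
  v₂-f∘prefix-increment N M gap a a₀≤a = v₂[f[s+2^E]-f[s]]≥M M (prefix e a) (e a) (begin
    M + prefix e a + 3         ≡⟨ regroup M (prefix e a) ⟩
    M + 2 + suc (prefix e a)   ≤⟨ +-monoˡ-≤ (suc (prefix e a)) (≤-trans (m≤n+m (M + 2) N) a₀≤a) ⟩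
    a + suc (prefix e a)       ≡⟨ +-suc a (prefix e a) ⟩
    suc (a + prefix e a)       ≤⟨ gap a (≤-trans (m≤m+n N (M + 2)) a₀≤a) ⟩
    e a                        ∎)
    where
    open ≤-Reasoning
    regroup : ∀ M p → M + p + 3 ≡ M + 2 + suc p
    regroup = ℕ-Solver.solve-∀

theorem1p9 : (e : ℕ → ℕ) → StrictlyIncreasing e →
    (N : ℕ) → NonZero N →
    (∀ k → N ≤ k → k + sumℕ< k (λ i → 2 ^ e i) < e k) →
    TwoDefinable f e
theorem1p9 e e-inc N _ gap M = e a₀ , λ m n e[a₀]≤m e[a₀]≤n →
  close {m} {n} (partial-beyond e e-inc a₀ e[a₀]≤m) (partial-beyond e e-inc a₀ e[a₀]≤n)
  where
  a₀ = N + (M + 2)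
  close : ∀ {m n} → Σ ℕ (λ k → (a₀ ≤ k) × (partial e m ≡ prefix e k)) → Σ ℕ (λ k → (a₀ ≤ k) × (partial e n ≡ prefix e k)) →
          TwoAdicSmall M (f (partial e m) ℚ.- f (partial e n))
  close (k , a₀≤k , x[m]≡prefix) (l , a₀≤l , x[n]≡prefix) rewrite x[m]≡prefix | x[n]≡prefix =
    v₂≥⇒TwoAdicSmall (v₂-differences (λ k → f (prefix e k)) a₀ (v₂-f∘prefix-increment e e-inc N M gap) k l a₀≤k a₀≤l)
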